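{- In the setting described in the context, for every facet $\tau$ of $\Lambda$, $\mathcal{R}_{\mathrm{Lex}}(\tau)$ is the unique minimal face of $\overline{\tau}-\bigcup_{\tau'\succ\tau}\overline{\tau'}$, where the union runs over facets $\tau'$ of $\Lambda$ with $\tau'\succ\tau$. In particular, listing the facets of $\Lambda$ in decreasing revlex order $\tau_1\succ\tau_2\succ\cdots$ gives a shelling of $\Lambda$.
   Context: Let $\mathbf{V}=\mathbf{V}_1\cup\cdots\cup\mathbf{V}_m$ (pairwise disjoint finite sets), $\mathbf{a}=(a_1,\ldots,a_m)$ nonnegative integers with $a_i\le|\mathbf{V}_i|$, and $1\le d\le\sum_i a_i$. $\Lambda$ is the simplicial complex on $\mathbf{V}$ whose faces are the $\tau\subseteq\mathbf{V}$ with $|\tau\cap\mathbf{V}_i|\le a_i$ for all $i$ and $|\tau|\le d$; its facets are the faces of size $d$. Order $\mathbf{V}$ totally by $\succ$ with $v\succ v'$ whenever $v\in\mathbf{V}_i$, $v'\in\mathbf{V}_j$, $i<j$. Revlex order on sets of equal size: $S\succ T$ if the $\succ$-least element of the symmetric difference lies in $T$. $\overline{\tau}$ denotes the set of all subsets of $\tau$. For a facet $\tau$, $\mathcal{R}_{\mathrm{Lex}}(\tau)=\{v\in\tau:\tau-\{v\}\subseteq\tau'\text{ for some facet }\tau'\succ\tau\}$. A shelling of a pure $(d-1)$-dimensional complex is an ordering $\tau_1,\ldots,\tau_s$ of its facets such that for each $i>1$, $\overline{\tau_i}\cap\bigcup_{j<i}\overline{\tau_j}$ is pure of dimension $d-2$.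 -}

module Defs where

open import Data.Nat using (ℕ; _≤_; _∸_)
open import Data.Fin using (Fin; _<_)
open import Data.Fin.Subset using (Subset; _∈_; _∉_; _⊆_; _∩_; _-_; ∣_∣)
open import Data.Vec using (tabulate; sum)
open import Data.Product using (Σ; ∃; _×_)
open import Relation.Nullary using (¬_)
open import Relation.Nullary.Decidable using (⌊_⌋)
open import Relation.Binary.PropositionalEquality using (_≡_)
import Data.Fin as F

-- Vertex set V = Fin n.  The total order ≻ on V is the order of indices:
-- v ≻ w  iff  w < v  (as elements of Fin n).  Every finite totally ordered
-- set is isomorphic to such a Fin n, so this is no loss of generality.
_≻ᵥ_ : ∀ {n} → Fin n → Fin n → Set
v ≻ᵥ w = w < v

-- The partition V = V_0 ∪ ... ∪ V_{m-1} is given by a colouring c : Fin n → Fin m;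
-- V i is the i-th block.
Block : ∀ {n m} → (Fin n → Fin m) → Fin m → Subset n
Block c i = tabulate (λ v → ⌊ c v F.≟ i ⌋)

Compatible : ∀ {n m} → (Fin n → Fin m) → Set
Compatible c = ∀ v w → c v < c w → v ≻ᵥ w

IsFace : ∀ {n m} → (Fin n → Fin m) → (Fin m → ℕ) → ℕ → Subset n → Set
IsFace c a d τ = (∀ i → ∣ τ ∩ Block c i ∣ ≤ a i) × ∣ τ ∣ ≤ d

IsFacet : ∀ {n m} → (Fin n → Fin m) → (Fin m → ℕ) → ℕ → Subset n → Set
IsFacet c a d τ = IsFace c a d τ × ∣ τ ∣ ≡ d

-- Revlex order: S ≻ T iff the ≻-least element of the symmetric difference lies in T.
-- The ≻-least element is the one of smallest index; so: there is v ∈ T, v ∉ S,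
-- such that S and T agree on all w with v ≻ w (i.e. all w of smaller index).
_≻ʳ_ : ∀ {n} → Subset n → Subset n → Set
S ≻ʳ T = ∃ λ v → v ∈ T × v ∉ S × (∀ w → v ≻ᵥ w → (w ∈ S → w ∈ T) × (w ∈ T → w ∈ S))

InDiff : ∀ {n m} → (Fin n → Fin m) → (Fin m → ℕ) → ℕ → Subset n → Subset n → Set
InDiff c a d τ σ = σ ⊆ τ × (∀ τ' → IsFacet c a d τ' → τ' ≻ʳ τ → ¬ (σ ⊆ τ'))

Minimal : ∀ {n} → (Subset n → Set) → Subset n → Set
Minimal P σ = P σ × (∀ ρ → P ρ → ρ ⊆ σ → ρ ≡ σ)

UniqueMinimal : ∀ {n} → (Subset n → Set) → Subset n → Set
UniqueMinimal P σ = Minimal P σ × (∀ ρ → Minimal P ρ → ρ ≡ σ)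

IsRLex : ∀ {n m} → (Fin n → Fin m) → (Fin m → ℕ) → ℕ → Subset n → Subset n → Set
IsRLex c a d τ R = ∀ v → (v ∈ R → RL v) × (RL v → v ∈ R)
  where
  RL : _ → Set
  RL v = v ∈ τ × (∃ λ τ' → IsFacet c a d τ' × τ' ≻ʳ τ × (τ - v) ⊆ τ')

InPrevUnion : ∀ {n m} → (Fin n → Fin m) → (Fin m → ℕ) → ℕ → Subset n → Subset n → Set
InPrevUnion c a d τ σ = σ ⊆ τ × (∃ λ τ' → IsFacet c a d τ' × τ' ≻ʳ τ × σ ⊆ τ')

-- A (finite) complex given by its face predicate K is pure of dimension k−1 (k = d−1 here):
-- it has a face, and every maximal face has exactly k elements.
PureOfSize : ∀ {n} → (Subset n → Set) → ℕ → Set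
PureOfSize K k = (∃ λ σ → K σ) ×
  (∀ σ → K σ → (∀ ρ → K ρ → σ ⊆ ρ → ρ ≡ σ) → ∣ σ ∣ ≡ k)

-- Decreasing revlex order of the facets is a shelling: for every facet τ other than
-- the first one (i.e. some facet τ' ≻ τ exists), closure(τ) ∩ ⋃_{τ' ≻ τ} closure(τ')
-- is pure of dimension d − 2.
RevlexIsShelling : ∀ {n m} → (Fin n → Fin m) → (Fin m → ℕ) → ℕ → Set
RevlexIsShelling c a d =
  ∀ τ → IsFacet c a d τ → (∃ λ τ' → IsFacet c a d τ' × τ' ≻ʳ τ) →
  PureOfSize (InPrevUnion c a d τ) (d ∸ 1)

module Submission where

-- Everything rests on an exchange property of the facets of Λ. Let τ' ≻ τ be
-- facets and x the least vertex of their symmetric difference, so x ∈ τ − τ'.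
-- Some u ∈ τ' − τ has the colour of x or a colour whose block is not full in
-- τ: otherwise, counting block by block, τ' would have fewer vertices than τ.
-- Then (τ − x) ∪ {u} is a facet containing τ − x, and it precedes τ because
-- τ and τ' agree below x, which forces u ≻ x.  Hence every earlier facet
-- misses some vertex of R_Lex(τ): the new faces of τ are exactly the faces
-- containing R_Lex(τ), and the maximal old ones are the sets τ − y with
-- y ∈ R_Lex(τ), all of size d − 1.

open import Defs
open import Data.Nat using (ℕ; _≤_)
open import Data.Fin using (Fin)
open import Data.Fin.Subset using (Subset; ∣_∣)
open import Data.Vec using (tabulate; sum)
open import Data.Product using (_×_)

open import Data.Bool.Base using (Bool; true; false; _∧_)
open import Data.Empty using (⊥-elim)
open import Data.Fin using (zero; suc; _≟_)
import Data.Fin.Properties as Fin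
open import Data.Fin.Subset using (_∈_; _∉_; _⊆_; _∩_; _∪_; _─_; _-_; ⁅_⁆; ⊥; ⊤)
import Data.Fin.Subset.Properties as Subset
open import Data.Nat using (zero; suc; _+_; _∸_; _<_; z≤n)
import Data.Nat.Properties as ℕ
open import Data.Product using (∃; _,_; proj₁; proj₂)
open import Data.Sum using (_⊎_; inj₁; inj₂)
open import Data.Vec using ([]; _∷_; lookup; here; there)
import Data.Vec.Properties as Vec
open import Function using (_∘_)
open import Relation.Nullary using (¬_; Dec; yes; no)
open import Relation.Nullary.Decidable using (⌊_⌋; _×-dec_; _⊎-dec_; ¬?)
open import Relation.Binary.PropositionalEquality
  using (_≡_; _≢_; refl; sym; trans; cong; cong₂; subst; subst₂; module ≡-Reasoning)
open import Algebra.Properties.CommutativeMonoid.Sum ℕ.+-0-commutativeMonoid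
  using (sum-syntax; ∑-distrib-+; sum-cong-≗; sum-replicate-zero)

toℕ : Bool → ℕ
toℕ false = 0
toℕ true  = 1

∑-mono-≤ : ∀ {m} {f g : Fin m → ℕ} → (∀ i → f i ≤ g i) → ∑[ i < m ] f i ≤ ∑[ i < m ] g i
∑-mono-≤ {zero}  f≤g = z≤n
∑-mono-≤ {suc m} f≤g = ℕ.+-mono-≤ (f≤g zero) (∑-mono-≤ (f≤g ∘ suc))

∑-mono-< : ∀ {m} {f g : Fin m → ℕ} → (∀ i → f i ≤ g i) → ∀ j → f j < g j →
           ∑[ i < m ] f i < ∑[ i < m ] g i
∑-mono-< f≤g zero    fj<gj = ℕ.+-mono-<-≤ fj<gj (∑-mono-≤ (f≤g ∘ suc))
∑-mono-< f≤g (suc j) fj<gj = ℕ.+-mono-≤-< (f≤g zero) (∑-mono-< (f≤g ∘ suc) j fj<gj)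

∑-indicator : ∀ {m} b (y : Fin m) → ∑[ k < m ] toℕ (b ∧ ⌊ y ≟ k ⌋) ≡ toℕ b
∑-indicator {m}     false y       = sum-replicate-zero m
∑-indicator {suc m} true  zero    = cong suc (sum-replicate-zero m)
∑-indicator {suc m} true  (suc y) = trans (sum-cong-≗ ⌊suc≟suc⌋) (∑-indicator true y)
  where
  -- ⌊_⌋ does not compute through the map′ in the definition of _≟_ on suc.
  ⌊suc≟suc⌋ : ∀ k → toℕ ⌊ suc y ≟ suc k ⌋ ≡ toℕ ⌊ y ≟ k ⌋
  ⌊suc≟suc⌋ k with y ≟ k
  ... | yes _ = refl
  ... | no  _ = refl

∣∷∣ : ∀ {n} b (p : Subset n) → ∣ b ∷ p ∣ ≡ toℕ b + ∣ p ∣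
∣∷∣ false p = refl
∣∷∣ true  p = refl

∑∣p∩Block∣≡∣p∣ : ∀ {n m} (c : Fin n → Fin m) (p : Subset n) →
                 ∑[ k < m ] ∣ p ∩ Block c k ∣ ≡ ∣ p ∣
∑∣p∩Block∣≡∣p∣ {m = m} c []      = sum-replicate-zero m
∑∣p∩Block∣≡∣p∣ {m = m} c (b ∷ p) = begin
  ∑[ k < m ] ∣ (b ∷ p) ∩ Block c k ∣
    ≡⟨ sum-cong-≗ (λ k → ∣∷∣ (b ∧ ⌊ c zero ≟ k ⌋) (p ∩ Block (c ∘ suc) k)) ⟩
  ∑[ k < m ] (toℕ (b ∧ ⌊ c zero ≟ k ⌋) + ∣ p ∩ Block (c ∘ suc) k ∣)
    ≡⟨ ∑-distrib-+ (λ k → toℕ (b ∧ ⌊ c zero ≟ k ⌋)) (λ k → ∣ p ∩ Block (c ∘ suc) k ∣) ⟩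
  ∑[ k < m ] toℕ (b ∧ ⌊ c zero ≟ k ⌋) + ∑[ k < m ] ∣ p ∩ Block (c ∘ suc) k ∣
    ≡⟨ cong₂ _+_ (∑-indicator b (c zero)) (∑∣p∩Block∣≡∣p∣ (c ∘ suc) p) ⟩
  toℕ b + ∣ p ∣
    ≡⟨ ∣∷∣ b p ⟨
  ∣ b ∷ p ∣ ∎
  where open ≡-Reasoning

∣p∩q∣≡∣[p-x]∩q∣+[x∈q] : ∀ {n} {p : Subset n} {x} (q : Subset n) → x ∈ p →
                        ∣ p ∩ q ∣ ≡ ∣ (p - x) ∩ q ∣ + toℕ (lookup q x)
∣p∩q∣≡∣[p-x]∩q∣+[x∈q] {p = true ∷ p} (β ∷ q) here = begin
  ∣ β ∷ (p ∩ q) ∣           ≡⟨ ∣∷∣ β (p ∩ q) ⟩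
  toℕ β + ∣ p ∩ q ∣         ≡⟨ ℕ.+-comm (toℕ β) ∣ p ∩ q ∣ ⟩
  ∣ p ∩ q ∣ + toℕ β         ≡⟨ cong (λ r → ∣ r ∩ q ∣ + toℕ β) (Subset.p─⊥≡p p) ⟨
  ∣ (p ─ ⊥) ∩ q ∣ + toℕ β   ∎
  where open ≡-Reasoning
∣p∩q∣≡∣[p-x]∩q∣+[x∈q] {p = true  ∷ p} (true  ∷ q) (there x∈p) = cong suc (∣p∩q∣≡∣[p-x]∩q∣+[x∈q] q x∈p)
∣p∩q∣≡∣[p-x]∩q∣+[x∈q] {p = true  ∷ p} (false ∷ q) (there x∈p) = ∣p∩q∣≡∣[p-x]∩q∣+[x∈q] q x∈p
∣p∩q∣≡∣[p-x]∩q∣+[x∈q] {p = false ∷ p} (_     ∷ q) (there x∈p) = ∣p∩q∣≡∣[p-x]∩q∣+[x∈q] q x∈p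

∣[p∪⁅x⁆]∩q∣≡∣p∩q∣+[x∈q] : ∀ {n} {p : Subset n} {x} (q : Subset n) → x ∉ p →
                          ∣ (p ∪ ⁅ x ⁆) ∩ q ∣ ≡ ∣ p ∩ q ∣ + toℕ (lookup q x)
∣[p∪⁅x⁆]∩q∣≡∣p∩q∣+[x∈q] {p = true  ∷ p} {zero} q x∉p = ⊥-elim (x∉p here)
∣[p∪⁅x⁆]∩q∣≡∣p∩q∣+[x∈q] {p = false ∷ p} {zero} (β ∷ q) _
  rewrite Subset.∪-identityʳ p = trans (∣∷∣ β (p ∩ q)) (ℕ.+-comm (toℕ β) ∣ p ∩ q ∣)
∣[p∪⁅x⁆]∩q∣≡∣p∩q∣+[x∈q] {p = true  ∷ p} {suc x} (true  ∷ q) x∉p =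
  cong suc (∣[p∪⁅x⁆]∩q∣≡∣p∩q∣+[x∈q] q (x∉p ∘ there))
∣[p∪⁅x⁆]∩q∣≡∣p∩q∣+[x∈q] {p = true  ∷ p} {suc x} (false ∷ q) x∉p = ∣[p∪⁅x⁆]∩q∣≡∣p∩q∣+[x∈q] q (x∉p ∘ there)
∣[p∪⁅x⁆]∩q∣≡∣p∩q∣+[x∈q] {p = false ∷ p} {suc x} (_     ∷ q) x∉p = ∣[p∪⁅x⁆]∩q∣≡∣p∩q∣+[x∈q] q (x∉p ∘ there)

∣p∩⊤∣≡∣p∣ : ∀ {n} (p : Subset n) → ∣ p ∩ ⊤ ∣ ≡ ∣ p ∣
∣p∩⊤∣≡∣p∣ p = cong ∣_∣ (Subset.∩-identityʳ p)

∣p∣≡∣p-x∣+1 : ∀ {n} {p : Subset n} {x} → x ∈ p → ∣ p ∣ ≡ ∣ p - x ∣ + 1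
∣p∣≡∣p-x∣+1 {p = p} {x} x∈p = begin
  ∣ p ∣                                ≡⟨ ∣p∩⊤∣≡∣p∣ p ⟨
  ∣ p ∩ ⊤ ∣                            ≡⟨ ∣p∩q∣≡∣[p-x]∩q∣+[x∈q] ⊤ x∈p ⟩
  ∣ (p - x) ∩ ⊤ ∣ + toℕ (lookup ⊤ x)   ≡⟨ cong₂ _+_ (∣p∩⊤∣≡∣p∣ (p - x)) (cong toℕ (Vec.lookup-replicate x true)) ⟩
  ∣ p - x ∣ + 1                        ∎
  where open ≡-Reasoning

∣p∪⁅x⁆∣≡∣p∣+1 : ∀ {n} {p : Subset n} {x} → x ∉ p → ∣ p ∪ ⁅ x ⁆ ∣ ≡ ∣ p ∣ + 1
∣p∪⁅x⁆∣≡∣p∣+1 {p = p} {x} x∉p = begin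
  ∣ p ∪ ⁅ x ⁆ ∣                    ≡⟨ ∣p∩⊤∣≡∣p∣ (p ∪ ⁅ x ⁆) ⟨
  ∣ (p ∪ ⁅ x ⁆) ∩ ⊤ ∣              ≡⟨ ∣[p∪⁅x⁆]∩q∣≡∣p∩q∣+[x∈q] ⊤ x∉p ⟩
  ∣ p ∩ ⊤ ∣ + toℕ (lookup ⊤ x)     ≡⟨ cong₂ _+_ (∣p∩⊤∣≡∣p∣ p) (cong toℕ (Vec.lookup-replicate x true)) ⟩
  ∣ p ∣ + 1                        ∎
  where open ≡-Reasoning

x∉p-x : ∀ {n} (p : Subset n) x → x ∉ p - x
x∉p-x (_ ∷ p) zero    ()
x∉p-x (_ ∷ p) (suc x) (there x∈p-x) = x∉p-x p x x∈p-x

p⊆q∧x∉p⇒p⊆q-x : ∀ {n} {p q : Subset n} {x} → p ⊆ q → x ∉ p → p ⊆ q - x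
p⊆q∧x∉p⇒p⊆q-x p⊆q x∉p w∈p = Subset.x∈p∧x≢y⇒x∈p-y (p⊆q w∈p) (λ { refl → x∉p w∈p })

⊆-or-∃∉ : ∀ {n} (p q : Subset n) → p ⊆ q ⊎ ∃ λ u → u ∈ p × u ∉ q
⊆-or-∃∉ p q with Fin.any? (λ u → u Subset.∈? p ×-dec ¬? (u Subset.∈? q))
... | yes escapee = inj₂ escapee
... | no ∄escapee = inj₁ p⊆q
  where
  p⊆q : p ⊆ q
  p⊆q {u} u∈p with u Subset.∈? q
  ... | yes u∈q = u∈q
  ... | no  u∉q = ⊥-elim (∄escapee (u , u∈p , u∉q))

exchange : ∀ {n} → Subset n → Fin n → Fin n → Subset n
exchange p x u = (p - x) ∪ ⁅ u ⁆

module _ {n} {p : Subset n} {x u : Fin n} (x∈p : x ∈ p) (u∉p : u ∉ p) where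

  private
    u∉p-x : u ∉ p - x
    u∉p-x = u∉p ∘ Subset.p─q⊆p p ⁅ x ⁆

  ∣exchange∣ : ∣ exchange p x u ∣ ≡ ∣ p ∣
  ∣exchange∣ = trans (∣p∪⁅x⁆∣≡∣p∣+1 u∉p-x) (sym (∣p∣≡∣p-x∣+1 x∈p))

  ∣exchange∩q∣ : ∀ q → ∣ exchange p x u ∩ q ∣ + toℕ (lookup q x) ≡ ∣ p ∩ q ∣ + toℕ (lookup q u)
  ∣exchange∩q∣ q = begin
    ∣ exchange p x u ∩ q ∣ + [x]      ≡⟨ cong (_+ [x]) (∣[p∪⁅x⁆]∩q∣≡∣p∩q∣+[x∈q] q u∉p-x) ⟩
    ∣ (p - x) ∩ q ∣ + [u] + [x]       ≡⟨ ℕ.+-assoc ∣ (p - x) ∩ q ∣ [u] [x] ⟩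
    ∣ (p - x) ∩ q ∣ + ([u] + [x])     ≡⟨ cong (∣ (p - x) ∩ q ∣ +_) (ℕ.+-comm [u] [x]) ⟩
    ∣ (p - x) ∩ q ∣ + ([x] + [u])     ≡⟨ ℕ.+-assoc ∣ (p - x) ∩ q ∣ [x] [u] ⟨
    ∣ (p - x) ∩ q ∣ + [x] + [u]       ≡⟨ cong (_+ [u]) (∣p∩q∣≡∣[p-x]∩q∣+[x∈q] q x∈p) ⟨
    ∣ p ∩ q ∣ + [u]                   ∎
    where
    open ≡-Reasoning
    [x] [u] : ℕ
    [x] = toℕ (lookup q x)
    [u] = toℕ (lookup q u)

  exchange-≻ʳ : ¬ x ≻ᵥ u → exchange p x u ≻ʳ p
  exchange-≻ʳ x⊁u = x , x∈p , x∉exchange , agree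
    where
    x∉exchange : x ∉ exchange p x u
    x∉exchange x∈e with Subset.x∈p∪q⁻ (p - x) ⁅ u ⁆ x∈e
    ... | inj₁ x∈p-x = x∉p-x p x x∈p-x
    ... | inj₂ x∈⁅u⁆ = u∉p (subst (_∈ p) (Subset.x∈⁅y⁆⇒x≡y u x∈⁅u⁆) x∈p)
    agree : ∀ w → x ≻ᵥ w → (w ∈ exchange p x u → w ∈ p) × (w ∈ p → w ∈ exchange p x u)
    agree w w<x = ∈p , λ w∈p → Subset.p⊆p∪q ⁅ u ⁆ (Subset.x∈p∧x≢y⇒x∈p-y w∈p w≢x)
      where
      w≢x : w ≢ x
      w≢x = Fin.<⇒≢ w<x
      ∈p : w ∈ exchange p x u → w ∈ p
      ∈p w∈e with Subset.x∈p∪q⁻ (p - x) ⁅ u ⁆ w∈e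
      ... | inj₁ w∈p-x = Subset.p─q⊆p p ⁅ x ⁆ w∈p-x
      ... | inj₂ w∈⁅u⁆ = ⊥-elim (x⊁u (subst (x ≻ᵥ_) (Subset.x∈⁅y⁆⇒x≡y u w∈⁅u⁆) w<x))

module _ {n m} (c : Fin n → Fin m) where

  lookup-Block : ∀ k x → lookup (Block c k) x ≡ ⌊ c x ≟ k ⌋
  lookup-Block k = Vec.lookup∘tabulate (λ v → ⌊ c v ≟ k ⌋)

  ∈-Block⁺ : ∀ {k x} → c x ≡ k → x ∈ Block c k
  ∈-Block⁺ {k} {x} refl = Vec.lookup⇒[]= x (Block c k) (trans (lookup-Block k x) (⌊≟-refl⌋ (c x ≟ c x)))
    where
    ⌊≟-refl⌋ : (d : Dec (c x ≡ c x)) → ⌊ d ⌋ ≡ true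
    ⌊≟-refl⌋ (yes _)  = refl
    ⌊≟-refl⌋ (no ¬eq) = ⊥-elim (¬eq refl)

  ∈-Block⁻ : ∀ {k x} → x ∈ Block c k → c x ≡ k
  ∈-Block⁻ {k} {x} x∈B with c x ≟ k | trans (sym (lookup-Block k x)) (Vec.[]=⇒lookup x∈B)
  ... | yes cx≡k | _ = cx≡k
  ... | no  _    | ()

  ∣exchange∩Block∣ : ∀ {p : Subset n} {x u} → x ∈ p → u ∉ p → ∀ k →
    ∣ exchange p x u ∩ Block c k ∣ + toℕ ⌊ c x ≟ k ⌋ ≡ ∣ p ∩ Block c k ∣ + toℕ ⌊ c u ≟ k ⌋
  ∣exchange∩Block∣ {p} {x} {u} x∈p u∉p k =
    subst₂ (λ bx bu → ∣ exchange p x u ∩ Block c k ∣ + toℕ bx ≡ ∣ p ∩ Block c k ∣ + toℕ bu)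
           (lookup-Block k x) (lookup-Block k u) (∣exchange∩q∣ x∈p u∉p (Block c k))

module _ {n m} (c : Fin n → Fin m) (a : Fin m → ℕ) (d : ℕ) where

  AdmissibleExchange : Subset n → Fin n → Fin n → Set
  AdmissibleExchange τ x u = c u ≡ c x ⊎ ∣ τ ∩ Block c (c u) ∣ < a (c u)

  exchange-isFacet : ∀ {τ x u} → IsFacet c a d τ → x ∈ τ → u ∉ τ → AdmissibleExchange τ x u →
                     IsFacet c a d (exchange τ x u)
  exchange-isFacet {τ} {x} {u} ((τ-bounded , _) , ∣τ∣≡d) x∈τ u∉τ admissible =
    (bounded , ℕ.≤-reflexive ∣e∣≡d) , ∣e∣≡d
    where
    ∣e∣≡d : ∣ exchange τ x u ∣ ≡ d
    ∣e∣≡d = trans (∣exchange∣ x∈τ u∉τ) ∣τ∣≡d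
    bounded : ∀ k → ∣ exchange τ x u ∩ Block c k ∣ ≤ a k
    bounded k = bound admissible (c u ≟ k) (c x ≟ k) (∣exchange∩Block∣ c x∈τ u∉τ k)
      where
      e t : ℕ
      e = ∣ exchange τ x u ∩ Block c k ∣
      t = ∣ τ ∩ Block c k ∣
      bound : AdmissibleExchange τ x u → (u? : Dec (c u ≡ k)) (x? : Dec (c x ≡ k)) →
              e + toℕ ⌊ x? ⌋ ≡ t + toℕ ⌊ u? ⌋ → e ≤ a k
      bound _ (no _) x? eq = begin
        e              ≤⟨ ℕ.m≤m+n e _ ⟩
        e + toℕ ⌊ x? ⌋ ≡⟨ eq ⟩
        t + 0          ≡⟨ ℕ.+-identityʳ t ⟩
        t              ≤⟨ τ-bounded k ⟩
        a k            ∎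
        where open ℕ.≤-Reasoning
      bound _ (yes _) (yes _) eq = ℕ.≤-trans (ℕ.≤-reflexive (ℕ.+-cancelʳ-≡ 1 e t eq)) (τ-bounded k)
      bound (inj₁ cu≡cx) (yes cu≡k) (no cx≢k) _ = ⊥-elim (cx≢k (trans (sym cu≡cx) cu≡k))
      bound (inj₂ room) (yes cu≡k) (no _) eq = begin
        e              ≡⟨ ℕ.+-identityʳ e ⟨
        e + 0          ≡⟨ eq ⟩
        t + 1          ≡⟨ ℕ.+-comm t 1 ⟩
        suc t          ≤⟨ subst (λ k → ∣ τ ∩ Block c k ∣ < a k) cu≡k room ⟩
        a k            ∎
        where open ℕ.≤-Reasoning

  no-admissible-exchange⇒∣τ'∣<∣τ∣ : ∀ {τ τ' x} → (∀ k → ∣ τ' ∩ Block c k ∣ ≤ a k) →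
    x ∈ τ → x ∉ τ' → (∀ u → u ∈ τ' → u ∉ τ → ¬ AdmissibleExchange τ x u) → ∣ τ' ∣ < ∣ τ ∣
  no-admissible-exchange⇒∣τ'∣<∣τ∣ {τ} {τ'} {x} τ'-bounded x∈τ x∉τ' inadmissible =
    subst₂ _<_ (∑∣p∩Block∣≡∣p∣ c τ') (∑∣p∩Block∣≡∣p∣ c τ)
      (∑-mono-< fewer-in-block (c x) fewer-in-block-of-x)
    where
    restrict : ∀ {k} → τ' ∩ Block c k ⊆ τ → τ' ∩ Block c k ⊆ τ ∩ Block c k
    restrict {k} ⊆τ w∈ = Subset.x∈p∩q⁺ (⊆τ w∈ , Subset.p∩q⊆q τ' (Block c k) w∈)

    fewer-in-block : ∀ k → ∣ τ' ∩ Block c k ∣ ≤ ∣ τ ∩ Block c k ∣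
    fewer-in-block k with ⊆-or-∃∉ (τ' ∩ Block c k) τ
    ... | inj₁ ⊆τ = Subset.p⊆q⇒∣p∣≤∣q∣ (restrict ⊆τ)
    ... | inj₂ (u , u∈τ'∩B , u∉τ) = ℕ.≤-trans (τ'-bounded k) (ℕ.≮⇒≥ no-room)
      where
      no-room : ¬ ∣ τ ∩ Block c k ∣ < a k
      no-room room = inadmissible u (Subset.p∩q⊆p τ' _ u∈τ'∩B) u∉τ
        (inj₂ (subst (λ k → ∣ τ ∩ Block c k ∣ < a k) (sym (∈-Block⁻ c (Subset.p∩q⊆q τ' _ u∈τ'∩B))) room))

    fewer-in-block-of-x : ∣ τ' ∩ Block c (c x) ∣ < ∣ τ ∩ Block c (c x) ∣
    fewer-in-block-of-x with ⊆-or-∃∉ (τ' ∩ Block c (c x)) τ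
    ... | inj₁ ⊆τ = Subset.p⊂q⇒∣p∣<∣q∣ (restrict ⊆τ , x ,
          Subset.x∈p∩q⁺ (x∈τ , ∈-Block⁺ c refl) , x∉τ' ∘ Subset.p∩q⊆p τ' _)
    ... | inj₂ (u , u∈τ'∩B , u∉τ) = ⊥-elim (inadmissible u (Subset.p∩q⊆p τ' _ u∈τ'∩B) u∉τ
          (inj₁ (∈-Block⁻ c (Subset.p∩q⊆q τ' _ u∈τ'∩B))))

  exchange-partner : ∀ {τ τ' x} → (∀ k → ∣ τ' ∩ Block c k ∣ ≤ a k) → ∣ τ' ∣ ≡ ∣ τ ∣ →
                     x ∈ τ → x ∉ τ' → ∃ λ u → u ∈ τ' × u ∉ τ × AdmissibleExchange τ x u
  exchange-partner {τ} {τ'} {x} τ'-bounded ∣τ'∣≡∣τ∣ x∈τ x∉τ'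
    with Fin.any? (λ u → u Subset.∈? τ' ×-dec ¬? (u Subset.∈? τ) ×-dec
                         (c u ≟ c x ⊎-dec ∣ τ ∩ Block c (c u) ∣ ℕ.<? a (c u)))
  ... | yes partner = partner
  ... | no ∄partner = ⊥-elim (ℕ.<-irrefl ∣τ'∣≡∣τ∣
          (no-admissible-exchange⇒∣τ'∣<∣τ∣ τ'-bounded x∈τ x∉τ' λ u u∈τ' u∉τ ok → ∄partner (u , u∈τ' , u∉τ , ok)))

  InRLex : Subset n → Fin n → Set
  InRLex τ v = v ∈ τ × ∃ λ τ' → IsFacet c a d τ' × τ' ≻ʳ τ × (τ - v) ⊆ τ'

  ≻ʳ-facet-misses-RLex : ∀ {τ τ'} → IsFacet c a d τ → IsFacet c a d τ' → τ' ≻ʳ τ →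
                          ∃ λ x → x ∉ τ' × InRLex τ x
  ≻ʳ-facet-misses-RLex {τ} {τ'} τ-facet ((τ'-bounded , _) , ∣τ'∣≡d) (x , x∈τ , x∉τ' , agree)
    with exchange-partner τ'-bounded (trans ∣τ'∣≡d (sym (proj₂ τ-facet))) x∈τ x∉τ'
  ... | u , u∈τ' , u∉τ , admissible =
    x , x∉τ' , x∈τ , exchange τ x u , exchange-isFacet τ-facet x∈τ u∉τ admissible ,
    exchange-≻ʳ x∈τ u∉τ (λ u<x → u∉τ (proj₁ (agree u u<x) u∈τ')) , Subset.p⊆p∪q ⁅ u ⁆

  InDiff⇒RLex⊆ : ∀ {τ R σ} → IsRLex c a d τ R → InDiff c a d τ σ → R ⊆ σ
  InDiff⇒RLex⊆ {σ = σ} R-is-RLex (σ⊆τ , σ-new) {v} v∈R with v Subset.∈? σ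
  ... | yes v∈σ = v∈σ
  ... | no  v∉σ with proj₁ (R-is-RLex v) v∈R
  ...   | _ , τ' , τ'-facet , τ'≻τ , τ-v⊆τ' =
    ⊥-elim (σ-new τ' τ'-facet τ'≻τ (τ-v⊆τ' ∘ p⊆q∧x∉p⇒p⊆q-x σ⊆τ v∉σ))

  RLex⊆⇒InDiff : ∀ {τ R σ} → IsFacet c a d τ → IsRLex c a d τ R → σ ⊆ τ → R ⊆ σ → InDiff c a d τ σ
  RLex⊆⇒InDiff τ-facet R-is-RLex σ⊆τ R⊆σ = σ⊆τ , λ τ' τ'-facet τ'≻τ σ⊆τ' →
    let (x , x∉τ' , x∈RLex) = ≻ʳ-facet-misses-RLex τ-facet τ'-facet τ'≻τ
    in x∉τ' (σ⊆τ' (R⊆σ (proj₂ (R-is-RLex x) x∈RLex)))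

  RLex-uniqueMinimal : ∀ {τ R} → IsFacet c a d τ → IsRLex c a d τ R → UniqueMinimal (InDiff c a d τ) R
  RLex-uniqueMinimal {τ} {R} τ-facet R-is-RLex =
    (R∈InDiff , λ ρ ρ∈InDiff ρ⊆R → Subset.⊆-antisym ρ⊆R (InDiff⇒RLex⊆ R-is-RLex ρ∈InDiff)) ,
    λ ρ (ρ∈InDiff , ρ-minimal) → sym (ρ-minimal R R∈InDiff (InDiff⇒RLex⊆ R-is-RLex ρ∈InDiff))
    where
    R∈InDiff : InDiff c a d τ R
    R∈InDiff = RLex⊆⇒InDiff τ-facet R-is-RLex (λ v∈R → proj₁ (proj₁ (R-is-RLex _) v∈R)) (λ v∈R → v∈R)

  InRLex⇒InPrevUnion : ∀ {τ y} → InRLex τ y → InPrevUnion c a d τ (τ - y)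
  InRLex⇒InPrevUnion {τ} {y} (_ , τ' , τ'-facet , τ'≻τ , τ-y⊆τ') =
    Subset.p─q⊆p τ ⁅ y ⁆ , τ' , τ'-facet , τ'≻τ , τ-y⊆τ'

  InPrevUnion⇒⊆τ-y : ∀ {τ σ} → IsFacet c a d τ → InPrevUnion c a d τ σ →
                     ∃ λ y → InRLex τ y × σ ⊆ τ - y
  InPrevUnion⇒⊆τ-y τ-facet (σ⊆τ , τ' , τ'-facet , τ'≻τ , σ⊆τ') =
    let (y , y∉τ' , y∈RLex) = ≻ʳ-facet-misses-RLex τ-facet τ'-facet τ'≻τ
    in y , y∈RLex , p⊆q∧x∉p⇒p⊆q-x σ⊆τ (y∉τ' ∘ σ⊆τ')

  revlex-shelling : RevlexIsShelling c a d
  revlex-shelling τ τ-facet (τ' , τ'-facet , τ'≻τ) = nonempty , maximal-faces-have-size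
    where
    nonempty : ∃ (InPrevUnion c a d τ)
    nonempty = let (x , _ , x∈RLex) = ≻ʳ-facet-misses-RLex τ-facet τ'-facet τ'≻τ
               in τ - x , InRLex⇒InPrevUnion x∈RLex

    maximal-faces-have-size : ∀ σ → InPrevUnion c a d τ σ →
      (∀ ρ → InPrevUnion c a d τ ρ → σ ⊆ ρ → ρ ≡ σ) → ∣ σ ∣ ≡ d ∸ 1
    maximal-faces-have-size σ σ∈union σ-maximal with InPrevUnion⇒⊆τ-y τ-facet σ∈union
    ... | y , y∈RLex@(y∈τ , _) , σ⊆τ-y = begin
      ∣ σ ∣             ≡⟨ cong ∣_∣ (σ-maximal (τ - y) (InRLex⇒InPrevUnion y∈RLex) σ⊆τ-y) ⟨
      ∣ τ - y ∣         ≡⟨ ℕ.m+n∸n≡m ∣ τ - y ∣ 1 ⟨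
      ∣ τ - y ∣ + 1 ∸ 1 ≡⟨ cong (_∸ 1) (∣p∣≡∣p-x∣+1 y∈τ) ⟨
      ∣ τ ∣ ∸ 1         ≡⟨ cong (_∸ 1) (proj₂ τ-facet) ⟩
      d ∸ 1             ∎
      where open ≡-Reasoning

lemma5p4 : (n m : ℕ) (c : Fin n → Fin m) (a : Fin m → ℕ) (d : ℕ)
    → Compatible c
    → (∀ i → a i ≤ ∣ Block c i ∣)
    → 1 ≤ d
    → d ≤ sum (tabulate a)
    → ((τ R : Subset n) → IsFacet c a d τ → IsRLex c a d τ R
         → UniqueMinimal (InDiff c a d τ) R)
      × RevlexIsShelling c a d
lemma5p4 n m c a d _ _ _ _ =
  (λ τ R τ-facet → RLex-uniqueMinimal c a d τ-facet) , revlex-shelling c a d
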